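{- Let $F$ be the sequential cellular automaton described in the context, $n\ge1$, $x\in\mathbb{B}^n$, and consider the sequence of partial configurations $F^{k,i}(x)$ along its execution. Suppose a partial configuration $s'$ is obtained from a partial configuration $s$ of this execution, whose active cell holds an intermediate symbol, by a sequence of consecutive elementary updates each of which is a propagation update. Then $N_0(s')=N_0(s)$ and $N_1(s')=N_1(s)$; i.e., throughout a propagation phase, the number of $0$ symbols (resp. $1$ symbols) in the configuration plus those contained in the active memory is preserved.
   Context: Let $\mathbb{B}=\{0,1\}$. An intermediate symbol is a triple $(c,v,M)$ with counter $c\in\{\circ,\bullet\}$, value $v\in\{0,1,X\}$ and memory $M\subseteq\mathbb{B}$, with $v\in M$ whenever $v\in\mathbb{B}$; $T$ is the set of these triples and $\Sigma=\mathbb{B}\cup T$; $\bar c$ is the other counter symbol. The local rule $f:\Sigma\times\Sigma\to\Sigma$, $f(a,y)$ with $a$ the left neighbour and $y$ the updated cell: (R1) $f(b,b)=b$; (R2) $f(b,b')=(\circ,X,\{b'\})$ for $b\ne b'$ in $\mathbb{B}$; (R3) $f((c,v,M),b)=(c,X,M\cup\{b\})$ if $b\notin M$, $=(c,b,M)$ if $b\in M$ ($b\in\mathbb{B}$); (R4) for $c'\ne c$: $f((c,v,M),(c',w,M'))=(c,X,M\cup\{w\})$ if $w\in\mathbb{B}\setminus M$, $=(c,w,M)$ if $w\in M\cup\{X\}$; (R5) $f((c,v,M),(c,w,M'))=(\bar c,X,\emptyset)$ if $M=\mathbb{B}$, $=b$ if $M=\{b\}$, arbitrary if $M=\emptyset$;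 (R6) $f(b,(c,v,M))=b$ for $b\in\mathbb{B}$. Configurations in $\Sigma^n$ are cyclic (cell $n$ is the left neighbour of cell $1$); one application of $F$ performs $z_i:=f(z_{i-1},z_i)$ for $i=1,\dots,n$ in order, using current values ($z_0:=z_n$). $F^{k,i}(x)$ denotes the configuration obtained from $x$ after $k$ applications of $F$ followed by the updates of cells $1,\dots,i$ (so $F^{k,0}(x)=F^k(x)$ and $F^{k,n}(x)=F^{k+1}(x)$); an elementary update is the passage from $F^{k,i-1}(x)$ to $F^{k,i}(x)$, updating cell $i$. It is a propagation update if it is an instance of (R3) or (R4), i.e. the left neighbour of cell $i$ holds an intermediate symbol and cell $i$ holds either a symbol of $\mathbb{B}$ or an intermediate symbol with a different counter. In $F^{k,i}(x)$ the active cell is cell $i$ (cell $n$ if $i=0$); if it holds an intermediate symbol, its memory $M$ is the active memory. For such a partial configuration $s$ and $b\in\mathbb{B}$, $N_b(s)$ is the number of cells of $s$ holding either $b$ or an intermediate symbol with value layer $b$, plus $1$ if $b\in M$ (and plus $0$ otherwise). -}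

module Defs where

open import Data.Bool using (Bool; true; false; T; if_then_else_)
open import Data.Bool.Properties using () renaming (_≟_ to _≟B_)
open import Data.Unit using (⊤; tt)
open import Data.Empty using (⊥)
open import Data.Product using (_×_; _,_)
open import Data.Nat using (ℕ; zero; suc; _+_)
open import Data.Nat.DivMod using (_mod_)
open import Data.Fin using (Fin) renaming (_≟_ to _≟F_)
open import Data.Vec using (tabulate; sum)
open import Relation.Nullary using (yes; no; ¬_)
import Relation.Nullary.Decidable
open import Relation.Binary.PropositionalEquality using (_≡_; subst; sym)

data Counter : Set where
  ∘c •c : Counter

other : Counter → Counter
other ∘c = •c
other •c = ∘c

_≟C_ : (a b : Counter) → Relation.Nullary.Dec (a ≡ b)
∘c ≟C ∘c = yes Relation.Binary.PropositionalEquality.refl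
∘c ≟C •c = no λ ()
•c ≟C ∘c = no λ ()
•c ≟C •c = yes Relation.Binary.PropositionalEquality.refl

-- values 0, 1 (as bits false/true) and X
data Val : Set where
  vB : Bool → Val
  vX : Val

-- memory M ⊆ 𝔹 as (0 ∈ M , 1 ∈ M)
Mem : Set
Mem = Bool × Bool

mem : Mem → Bool → Bool
mem (m0 , m1) false = m0
mem (m0 , m1) true  = m1

ins : Mem → Bool → Mem
ins (m0 , m1) false = (true , m1)
ins (m0 , m1) true  = (m0 , true)

∅ : Mem
∅ = (false , false)

single : Bool → Mem
single b = ins ∅ b

Valid : Val → Mem → Set
Valid (vB b) M = T (mem M b)
Valid vX M = ⊤

record Inter : Set where
  constructor inter
  field
    ctr : Counter
    val : Val
    memo : Mem
    ok : Valid val memo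
open Inter public

data Sym : Set where
  bit : Bool → Sym
  int : Inter → Sym

-- (c, v, M) receiving bit b  (rules R3, and R4 with w ∈ 𝔹)
absorb : Counter → Mem → Bool → Sym
absorb c M b with mem M b in eq
... | true  = int (inter c (vB b) M (subst T (sym eq) tt))
... | false = int (inter c vX (ins M b) tt)

-- The local rule f(a, y); the argument g supplies the "arbitrary" value of
-- rule R5 in the case M = ∅ (it receives the left neighbour and the cell).
f : (Inter → Inter → Sym) → Sym → Sym → Sym
f g (bit a) (bit b) with a ≟B b
... | yes _ = bit b
... | no  _ = int (inter ∘c vX (single b) tt)
f g (bit a) (int _) = bit a
f g (int (inter c v M _)) (bit b) = absorb c M b
f g (int L@(inter c v M _)) (int Y@(inter c' w M' _)) with c ≟C c'
f g (int L@(inter c v M _)) (int Y@(inter c' (vB b) M' _)) | no _ = absorb c M b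
f g (int L@(inter c v M _)) (int Y@(inter c' vX M' _))     | no _ = int (inter c vX M tt)
f g (int L@(inter c v (true , true) _))   (int Y) | yes _ = int (inter (other c) vX ∅ tt)
f g (int L@(inter c v (true , false) _))  (int Y) | yes _ = bit false
f g (int L@(inter c v (false , true) _))  (int Y) | yes _ = bit true
f g (int L@(inter c v (false , false) _)) (int Y) | yes _ = g L Y

-- Cyclic configurations of n = suc m cells; cell index j : Fin (suc m)
-- corresponds to cell j+1 of the paper.
Config : ℕ → Set
Config m = Fin (suc m) → Sym

left : (m : ℕ) → Fin (suc m) → Fin (suc m)
left m j = (Data.Fin.toℕ j + m) mod (suc m)

update : (Inter → Inter → Sym) → (m : ℕ) → Fin (suc m) → Config m → Config m
update g m j z k with k ≟F j
... | yes _ = f g (z (left m j)) (z j)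
... | no  _ = z k

-- cell updated by the elementary update number t (t = k*n + i updates cell i+1)
updCell : (m : ℕ) → ℕ → Fin (suc m)
updCell m t = t mod (suc m)

-- run g m x t = F^{k,i}(x) where t = k*n + i
run : (Inter → Inter → Sym) → (m : ℕ) → (Fin (suc m) → Bool) → ℕ → Config m
run g m x zero    = λ j → bit (x j)
run g m x (suc t) = update g m (updCell m t) (run g m x t)

-- active cell of F^{k,i}: cell i, or cell n if i = 0
activeCell : (m : ℕ) → ℕ → Fin (suc m)
activeCell m t = (t + m) mod (suc m)

IsInter : Sym → Set
IsInter (bit _) = ⊥
IsInter (int _) = ⊤

-- the elementary update number t (from F^{k,i-1} to F^{k,i}) is a propagation
-- update: instance of R3 or R4.
IsPropagation : Sym → Sym → Set
IsPropagation (int L) (bit _) = ⊤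
IsPropagation (int L) (int Y) = ¬ (ctr L ≡ ctr Y)
IsPropagation (bit _) _ = ⊥

PropagationStep : (Inter → Inter → Sym) → (m : ℕ) → (Fin (suc m) → Bool) → ℕ → Set
PropagationStep g m x t =
  IsPropagation (run g m x t (left m (updCell m t))) (run g m x t (updCell m t))

cellCount : Bool → Sym → ℕ
cellCount b (bit a) = if Relation.Nullary.Decidable.⌊ a ≟B b ⌋ then 1 else 0
cellCount b (int (inter _ (vB a) _ _)) = cellCount b (bit a)
cellCount b (int (inter _ vX _ _)) = 0

memCount : Bool → Sym → ℕ
memCount b (bit _) = 0
memCount b (int (inter _ _ M _)) = if mem M b then 1 else 0

N : (Inter → Inter → Sym) → (m : ℕ) → (Fin (suc m) → Bool) → Bool → ℕ → ℕ
N g m x b t = sum (tabulate (λ j → cellCount b (run g m x t j)))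
            + memCount b (run g m x t (activeCell m t))

-- Each propagation update rewrites only the updated cell y, to f(a, y) with a the active
-- cell, and makes the updated cell the new active cell. Rules R3 and R4 merely move a bit
-- between the value layer and the memory: counting y's value layer and a's memory before
-- against the value layer and memory of f(a, y) after gives the same number for each bit.
-- All other cells are untouched, so N₀ and N₁ are unchanged by each step of the phase.
module Submission where

open import Defs
open import Data.Nat.Properties
  using (+-0-commutativeMonoid; +-commutativeSemigroup; +-suc; +-identityʳ; n<1+n; <-trans; +-monoʳ-<; m≤m+n)
open import Algebra.Properties.CommutativeMonoid.Sum +-0-commutativeMonoid as Σ
  using (sum-remove; sum-cong-≗)
open import Algebra.Properties.CommutativeSemigroup +-commutativeSemigroup
  using (xy∙z≈xz∙y)
open import Data.Bool using (Bool; true; false; if_then_else_)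
open import Data.Fin using (Fin; toℕ; punchIn) renaming (zero to fzero; suc to fsuc; _≟_ to _≟F_)
open import Data.Fin.Properties using (toℕ-fromℕ<; toℕ-injective; punchInᵢ≢i)
open import Data.Nat using (ℕ; suc; zero; _+_; _≤_; _<_; _%_)
open import Data.Nat.DivMod using (_mod_; %-distribˡ-+; m%n%n≡m%n; [m+n]%n≡m%n)
open import Data.Product using (_×_; _,_)
open import Data.Vec using (tabulate; sum)
open import Data.Vec.Functional using (removeAt)
open import Function using (_∘_)
open import Relation.Binary.PropositionalEquality
open import Relation.Nullary using (yes; no; contradiction)

toℕ-mod : ∀ a n → toℕ (a mod suc n) ≡ a % suc n
toℕ-mod a n = toℕ-fromℕ< _

activeCell-suc : ∀ m u → activeCell m (suc u) ≡ updCell m u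
activeCell-suc m u = toℕ-injective (begin
  toℕ (activeCell m (suc u))  ≡⟨ toℕ-mod (suc u + m) m ⟩
  (suc u + m) % suc m         ≡⟨ cong (_% suc m) (sym (+-suc u m)) ⟩
  (u + suc m) % suc m         ≡⟨ [m+n]%n≡m%n u (suc m) ⟩
  u % suc m                   ≡⟨ sym (toℕ-mod u m) ⟩
  toℕ (updCell m u)           ∎)
  where open ≡-Reasoning

left-updCell : ∀ m u → left m (updCell m u) ≡ activeCell m u
left-updCell m u = toℕ-injective (begin
  toℕ (left m (updCell m u))           ≡⟨ toℕ-mod (toℕ (updCell m u) + m) m ⟩
  (toℕ (updCell m u) + m) % suc m      ≡⟨ cong (λ k → (k + m) % suc m) (toℕ-mod u m) ⟩
  (u % suc m + m) % suc m              ≡⟨ %-distribˡ-+ (u % suc m) m (suc m) ⟩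
  (u % suc m % suc m + m % suc m) % suc m
                                       ≡⟨ cong (λ k → (k + m % suc m) % suc m) (m%n%n≡m%n u (suc m)) ⟩
  (u % suc m + m % suc m) % suc m      ≡⟨ sym (%-distribˡ-+ u m (suc m)) ⟩
  (u + m) % suc m                      ≡⟨ sym (toℕ-mod (u + m) m) ⟩
  toℕ (activeCell m u)                 ∎)
  where open ≡-Reasoning

sum-tabulate : ∀ {k} (h : Fin k → ℕ) → sum (tabulate h) ≡ Σ.sum h
sum-tabulate {zero}  h = refl
sum-tabulate {suc k} h = cong (h fzero +_) (sum-tabulate (h ∘ fsuc))

removeAt-cong-≢ : ∀ {k} (h h' : Fin (suc k) → ℕ) (c : Fin (suc k)) →
                  (∀ i → i ≢ c → h' i ≡ h i) → ∀ i → removeAt h' c i ≡ removeAt h c i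
removeAt-cong-≢ h h' c agree i = agree (punchIn c i) (punchInᵢ≢i c i)

sum-tabulate-exchange : ∀ {k} (h h' : Fin (suc k) → ℕ) (c : Fin (suc k)) {p q : ℕ} →
                        (∀ i → i ≢ c → h' i ≡ h i) → h' c + p ≡ h c + q →
                        sum (tabulate h') + p ≡ sum (tabulate h) + q
sum-tabulate-exchange h h' c {p} {q} agree exchange = begin
  sum (tabulate h') + p                  ≡⟨ cong (_+ p) (trans (sum-tabulate h') (sum-remove h')) ⟩
  h' c + Σ.sum (removeAt h' c) + p       ≡⟨ xy∙z≈xz∙y (h' c) _ p ⟩
  h' c + p + Σ.sum (removeAt h' c)       ≡⟨ cong₂ _+_ exchange (sum-cong-≗ (removeAt-cong-≢ h h' c agree)) ⟩
  h c + q + Σ.sum (removeAt h c)         ≡⟨ xy∙z≈xz∙y (h c) q _ ⟩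
  h c + Σ.sum (removeAt h c) + q         ≡⟨ cong (_+ q) (sym (trans (sum-tabulate h) (sum-remove h))) ⟩
  sum (tabulate h) + q                   ∎
  where open ≡-Reasoning

memBit : Bool → Mem → ℕ
memBit b M = if mem M b then 1 else 0

absorb-conserves : ∀ b c M a →
                   cellCount b (absorb c M a) + memCount b (absorb c M a) ≡ cellCount b (bit a) + memBit b M
absorb-conserves false c (false , false) false = refl
absorb-conserves false c (false , false) true  = refl
absorb-conserves false c (false , true)  false = refl
absorb-conserves false c (false , true)  true  = refl
absorb-conserves false c (true  , false) false = refl
absorb-conserves false c (true  , false) true  = refl
absorb-conserves false c (true  , true)  false = refl
absorb-conserves false c (true  , true)  true  = refl
absorb-conserves true  c (false , false) false = refl
absorb-conserves true  c (false , false) true  = refl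
absorb-conserves true  c (false , true)  false = refl
absorb-conserves true  c (false , true)  true  = refl
absorb-conserves true  c (true  , false) false = refl
absorb-conserves true  c (true  , false) true  = refl
absorb-conserves true  c (true  , true)  false = refl
absorb-conserves true  c (true  , true)  true  = refl

propagation-conserves : ∀ g b L Y → IsPropagation L Y →
                        cellCount b (f g L Y) + memCount b (f g L Y) ≡ cellCount b Y + memCount b L
propagation-conserves g b (int (inter c  v M _)) (bit a) _ = absorb-conserves b c M a
propagation-conserves g b (int (inter ∘c v M _)) (int (inter ∘c w      _ _)) c≢c = contradiction refl c≢c
propagation-conserves g b (int (inter •c v M _)) (int (inter •c w      _ _)) c≢c = contradiction refl c≢c
propagation-conserves g b (int (inter ∘c v M _)) (int (inter •c (vB a) _ _)) _   = absorb-conserves b ∘c M a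
propagation-conserves g b (int (inter •c v M _)) (int (inter ∘c (vB a) _ _)) _   = absorb-conserves b •c M a
propagation-conserves g b (int (inter ∘c v M _)) (int (inter •c vX     _ _)) _   = refl
propagation-conserves g b (int (inter •c v M _)) (int (inter ∘c vX     _ _)) _   = refl

update-self : ∀ g m c z → update g m c z c ≡ f g (z (left m c)) (z c)
update-self g m c z with c ≟F c
... | yes _   = refl
... | no  c≢c = contradiction refl c≢c

update-≢ : ∀ g m c z k → k ≢ c → update g m c z k ≡ z k
update-≢ g m c z k k≢c with k ≟F c
... | yes k≡c = contradiction k≡c k≢c
... | no  _   = refl

N-suc : ∀ g m x b u → PropagationStep g m x u → N g m x b (suc u) ≡ N g m x b u
N-suc g m x b u step = begin
  N g m x b (suc u)                                                ≡⟨ cong (λ a → S' + memCount b (z' a)) (activeCell-suc m u) ⟩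
  S' + memCount b (z' c)                                           ≡⟨ sum-tabulate-exchange (cellCount b ∘ z) (cellCount b ∘ z') c
                                                                        (λ i i≢c → cong (cellCount b) (update-≢ g m c z i i≢c)) exchange ⟩
  sum (tabulate (cellCount b ∘ z)) + memCount b (z (activeCell m u)) ∎
  where
  open ≡-Reasoning
  c : Fin (suc m)
  c = updCell m u
  z z' : Config m
  z  = run g m x u
  z' = run g m x (suc u)
  S' : ℕ
  S' = sum (tabulate (cellCount b ∘ z'))
  weight : Sym → ℕ
  weight s = cellCount b s + memCount b s
  exchange : weight (z' c) ≡ cellCount b (z c) + memCount b (z (activeCell m u))
  exchange = begin
    weight (z' c)                                          ≡⟨ cong weight (update-self g m c z) ⟩
    weight (f g (z (left m c)) (z c))                      ≡⟨ propagation-conserves g b (z (left m c)) (z c) step ⟩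
    cellCount b (z c) + memCount b (z (left m c))          ≡⟨ cong (λ a → cellCount b (z c) + memCount b (z a)) (left-updCell m u) ⟩
    cellCount b (z c) + memCount b (z (activeCell m u))    ∎

constant-on-range : {A : Set} (φ : ℕ → A) (t j : ℕ) → (∀ u → t ≤ u → u < t + j → φ (suc u) ≡ φ u) → φ (t + j) ≡ φ t
constant-on-range φ t zero    _      = cong φ (+-identityʳ t)
constant-on-range φ t (suc j) steady = begin
  φ (t + suc j)   ≡⟨ cong φ (+-suc t j) ⟩
  φ (suc (t + j)) ≡⟨ steady (t + j) (m≤m+n t j) t+j<t+1+j ⟩
  φ (t + j)       ≡⟨ constant-on-range φ t j (λ u t≤u u<t+j → steady u t≤u (<-trans u<t+j t+j<t+1+j)) ⟩
  φ t             ∎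
  where
  open ≡-Reasoning
  t+j<t+1+j : t + j < t + suc j
  t+j<t+1+j = +-monoʳ-< t (n<1+n j)

lemma1 : (g : Inter → Inter → Sym) (m : ℕ) (x : Fin (suc m) → Bool) (t j : ℕ) →
         IsInter (run g m x t (activeCell m t)) →
         (∀ u → t ≤ u → u < t + j → PropagationStep g m x u) →
         (N g m x false (t + j) ≡ N g m x false t) × (N g m x true (t + j) ≡ N g m x true t)
lemma1 g m x t j _ propagation = conserved false , conserved true
  where
  conserved : ∀ b → N g m x b (t + j) ≡ N g m x b t
  conserved b = constant-on-range (N g m x b) t j
                  (λ u t≤u u<t+j → N-suc g m x b u (propagation u t≤u u<t+j))
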